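{- Let $G$ be a (finite, simple) graph with $mad(G)<3$. Then $ch_3^d(G)\le 8$.
   Context: For a graph $G$ and an integer $r\ge 1$, an $r$-dynamic coloring of $G$ is a proper vertex coloring $\phi$ such that for every vertex $v$, the neighborhood $N_G(v)$ contains at least $\min\{r,\deg_G(v)\}$ distinct colors. Given a list assignment $L$, $G$ is $r$-dynamically $L$-colorable if it has an $r$-dynamic coloring $\phi$ with $\phi(v)\in L(v)$ for all $v$. The list $r$-dynamic chromatic number $ch_r^d(G)$ is the least $k$ such that $G$ is $r$-dynamically $L$-colorable for every list assignment $L$ with $|L(v)|\ge k$ for all $v$. The maximum average degree $mad(G)$ is the maximum of $2|E(H)|/|V(H)|$ over all subgraphs $H$ of $G$ with at least one vertex. -}

module Defs where

open import Data.Nat using (ℕ; _≤_; _<_; _*_; _⊓_; suc)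
open import Data.Nat.Properties using (_≟_)
open import Data.Fin using (Fin; toℕ)
open import Data.Fin.Properties using () renaming (_<?_ to _<ᶠ?_)
open import Data.Bool using (Bool; true; false; _∧_)
open import Data.List using (List; length; filter; map; allFin; concatMap)
open import Data.List.Membership.Propositional using (_∈_)
open import Data.List.Relation.Unary.Unique.Propositional using (Unique)
open import Data.List.Extrema using ()
open import Data.List using (deduplicate)
open import Data.Product using (Σ; _×_; _,_)
open import Relation.Binary.PropositionalEquality using (_≡_; _≢_)
open import Relation.Nullary using (¬_)
open import Relation.Nullary.Decidable using (does)
open import Relation.Unary using (Decidable)

record Graph : Set where
  field
    n     : ℕ
    adj   : Fin n → Fin n → Bool
    sym   : ∀ u v → adj u v ≡ adj v u
    irrefl : ∀ v → adj v v ≡ false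
open Graph public

nbrs : (G : Graph) → Fin (n G) → List (Fin (n G))
nbrs G v = filter (λ u → adj G v u ≡? true) (allFin (n G))
  where
    open import Data.Bool.Properties using () renaming (_≟_ to _≡?_)

deg : (G : Graph) → Fin (n G) → ℕ
deg G v = length (nbrs G v)

numNbrColours : (G : Graph) → (Fin (n G) → ℕ) → Fin (n G) → ℕ
numNbrColours G φ v = length (deduplicate _≟_ (map φ (nbrs G v)))

Proper : (G : Graph) → (Fin (n G) → ℕ) → Set
Proper G φ = ∀ u v → adj G u v ≡ true → φ u ≢ φ v

Dynamic : ℕ → (G : Graph) → (Fin (n G) → ℕ) → Set
Dynamic r G φ = Proper G φ × (∀ v → r ⊓ deg G v ≤ numNbrColours G φ v)

-- A list assignment: each vertex gets a finite set of colours, represented as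
-- a duplicate-free list, so |L(v)| = length (L v).
ListAssignment : Graph → Set
ListAssignment G = Fin (n G) → List ℕ

DynamicallyLColourable : ℕ → (G : Graph) → ListAssignment G → Set
DynamicallyLColourable r G L =
  Σ (Fin (n G) → ℕ) λ φ → (∀ v → φ v ∈ L v) × Dynamic r G φ

-- ch_r^d(G) ≤ k : every list assignment with |L(v)| ≥ k admits an
-- r-dynamic L-colouring.
ListDynChromatic≤ : ℕ → (G : Graph) → ℕ → Set
ListDynChromatic≤ r G k =
  (L : ListAssignment G) → (∀ v → Unique (L v)) → (∀ v → k ≤ length (L v)) →
  DynamicallyLColourable r G L

record Subgraph (G : Graph) : Set where
  field
    S      : Fin (n G) → Bool
    F      : Fin (n G) → Fin (n G) → Bool
    F⊆adj  : ∀ u v → F u v ≡ true → adj G u v ≡ true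
    F-sym  : ∀ u v → F u v ≡ F v u
    F-in-S : ∀ u v → F u v ≡ true → (S u ≡ true) × (S v ≡ true)
open Subgraph public

vCount : {G : Graph} → Subgraph G → ℕ
vCount {G} H = length (filter (λ u → S H u ≡? true) (allFin (n G)))
  where
    open import Data.Bool.Properties using () renaming (_≟_ to _≡?_)

eCount : {G : Graph} → Subgraph G → ℕ
eCount {G} H =
  length (concatMap (λ u → filter (λ v → F H u v ≡? true)
                                  (filter (λ v → u <ᶠ? v) (allFin (n G))))
                    (allFin (n G)))
  where
    open import Data.Bool.Properties using () renaming (_≟_ to _≡?_)

-- mad(G) < q  (q a natural number): every subgraph H with at least one vertex
-- has average degree 2|E(H)|/|V(H)| < q, i.e. 2|E(H)| < q |V(H)|.
MadLessThan : (G : Graph) → ℕ → Set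
MadLessThan G q = (H : Subgraph G) → 1 ≤ vCount H → 2 * eCount H < q * vCount H

module Submission where

-- Minimal counterexample: by induction on |C|, every induced subgraph G[C] has a 3-dynamic
-- L-colouring. A vertex z added to a coloured graph must avoid the colours of its neighbours and,
-- for every neighbour that still sees fewer than 3 colours, the at most 2 colours it sees; so z has
-- at most 3·deg z forbidden colours. With 8 colours per list this reduces three configurations:
--   * a vertex of degree ≤ 1;
--   * a 2-vertex v with a neighbour u of degree ≤ 3: colour G[C] − v, recolour u so that it differs
--     from the other neighbour of v, then add v;
--   * a vertex c of degree ≤ 5 with at most one neighbour of degree ≠ 2: delete c and its set T of
--     2-neighbours, colour c avoiding also the colours of the far neighbours of T, then add back the
--     vertices of T, each of which now sees two colours.
-- If none occurs, discharging contradicts mad(G) < 3: a d-vertex starts with charge 2d − 6 and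
-- gives 1 to each 2-neighbour; every final charge is non-negative, while their sum 4|E| − 6|V| is
-- negative.

open import Algebra.Properties.CommutativeSemigroup using (interchange)
open import Data.Bool using (Bool; true; false; _∧_; _∨_; not; if_then_else_)
open import Data.Bool.Properties using (∨-zeroʳ; ∨-identityʳ; ∧-identityʳ; ∧-zeroʳ; ¬-not) renaming (_≟_ to _≟ᵇ_)
open import Data.Empty using (⊥; ⊥-elim)
open import Data.Fin using (Fin) renaming (_<_ to _<ᶠ_)
open import Data.Fin.Properties using () renaming (_≟_ to _≟ᶠ_; _<?_ to _<ᶠ?_; <-asym to <ᶠ-asym; <-cmp to <ᶠ-cmp)
open import Data.List using (List; []; _∷_; [_]; _++_; length; map; filter; concatMap; allFin; deduplicate)
open import Data.List.Membership.Propositional using (_∈_; _∉_; find; lose)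
open import Data.List.Membership.Propositional.Properties
  using (∈-∃++; ∈-++⁻; ∈-++⁺ˡ; ∈-++⁺ʳ; ∈-map⁺; ∈-map⁻; ∈-filter⁺; ∈-filter⁻; ∈-allFin;
         ∈-deduplicate⁺; ∈-deduplicate⁻; ∈-concatMap⁺; ∈-length)
open import Data.List.Properties
  using (length-++; length-++-sucʳ; length-map; length-filter; filter-≐; filter-none; map-cong-local)
open import Data.List.Relation.Binary.Subset.Propositional using (_⊆_)
open import Data.List.Relation.Unary.All as All using (All; all?)
open import Data.List.Relation.Unary.All.Properties using (¬All⇒Any¬)
open import Data.List.Relation.Unary.Any as Any using (Any; here; there; any?)
open import Data.List.Relation.Unary.Unique.Propositional using (Unique; []; _∷_)
open import Data.List.Relation.Unary.Unique.Propositional.Properties using (allFin⁺; filter⁺)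
open import Data.List.Relation.Unary.Unique.DecPropositional.Properties using (deduplicate-!)
open import Data.Nat using (ℕ; suc; pred; s≤s⁻¹; _+_; _*_; _⊓_; _≤_; _<_; z≤n; s≤s; _≤?_)
open import Data.Nat.Induction using (<-wellFounded)
open import Data.Nat.Properties
  using (_≟_; ≤-refl; ≤-reflexive; ≤-trans; ≤-antisym; <⇒≱; ≰⇒>; n≤1+n; m≤m+n; suc[m]≤n⇒m≤pred[n];
         +-comm; +-suc; +-identityʳ; +-mono-≤; +-monoˡ-≤; +-monoʳ-≤; +-cancelʳ-≤;
         *-comm; *-assoc; *-suc; *-zeroʳ; *-distribˡ-+; *-monoʳ-≤; *-monoʳ-<; m⊓n≤m; m⊓n≤n; ⊓-zeroʳ; ⊓-monoˡ-≤;
         +-commutativeSemigroup; module ≤-Reasoning)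
open import Data.Product using (Σ; ∃-syntax; _×_; _,_; proj₁; proj₂)
open import Data.Sum using (_⊎_; inj₁; inj₂)
open import Function using (_∘_; case_of_)
import Induction.WellFounded as WF
open import Level using (0ℓ)
import Relation.Binary.Construct.On as On
open import Relation.Binary.Definitions using (Tri; tri<; tri≈; tri>)
open import Relation.Binary.PropositionalEquality
  using (_≡_; _≢_; refl; sym; trans; cong; cong₂; subst; subst₂; module ≡-Reasoning)
open import Relation.Nullary using (¬_; Dec; yes; no; does; _×-dec_)
open import Relation.Unary.Properties using (∁?)

open import Data.List.Membership.DecPropositional _≟_ using (_∈?_)
open import Defs hiding (sym)

module _ {A : Set} where

  Unique-⊆⇒length≤ : {xs ys : List A} → Unique xs → xs ⊆ ys → length xs ≤ length ys
  Unique-⊆⇒length≤ {[]} _ _ = z≤n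
  Unique-⊆⇒length≤ {x ∷ xs} (x∉xs ∷ u) xs⊆ys with ys₁ , ys₂ , refl ← ∈-∃++ (xs⊆ys (here refl)) =
    subst (suc (length xs) ≤_) (sym (length-++-sucʳ ys₁ x ys₂)) (s≤s (Unique-⊆⇒length≤ u xs⊆ys₁ys₂))
    where
    xs⊆ys₁ys₂ : xs ⊆ ys₁ ++ ys₂
    xs⊆ys₁ys₂ {y} y∈xs with ∈-++⁻ ys₁ (xs⊆ys (there y∈xs))
    ... | inj₁ y∈ys₁ = ∈-++⁺ˡ y∈ys₁
    ... | inj₂ (here refl) = ⊥-elim (All.lookup x∉xs y∈xs refl)
    ... | inj₂ (there y∈ys₂) = ∈-++⁺ʳ ys₁ y∈ys₂

  Unique-⊆⊇⇒length≡ : {xs ys : List A} → Unique xs → Unique ys → xs ⊆ ys → ys ⊆ xs → length xs ≡ length ys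
  Unique-⊆⊇⇒length≡ uxs uys xs⊆ys ys⊆xs = ≤-antisym (Unique-⊆⇒length≤ uxs xs⊆ys) (Unique-⊆⇒length≤ uys ys⊆xs)

  other-member : {xs : List A} {x : A} → Unique xs → length xs ≡ 2 → x ∈ xs → ∃[ y ] y ∈ xs × y ≢ x
  other-member {_ ∷ _ ∷ []} (x≢ ∷ _) refl (here refl) = _ , there (here refl) , All.head x≢ ∘ sym
  other-member {_ ∷ _ ∷ []} (y≢ ∷ _) refl (there (here refl)) = _ , here refl , All.head y≢

distinct : List ℕ → ℕ
distinct cs = length (deduplicate _≟_ cs)

distinct-mono : {cs ds : List ℕ} → cs ⊆ ds → distinct cs ≤ distinct ds
distinct-mono {cs} cs⊆ds =
  Unique-⊆⇒length≤ (deduplicate-! _≟_ cs) (∈-deduplicate⁺ _≟_ ∘ cs⊆ds ∘ ∈-deduplicate⁻ _≟_ cs)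

distinct-∷-fresh : {c : ℕ} {cs ds : List ℕ} → c ∉ cs → c ∷ cs ⊆ ds → suc (distinct cs) ≤ distinct ds
distinct-∷-fresh {c} {cs} c∉cs c∷cs⊆ds = Unique-⊆⇒length≤ unique ⊆ds
  where
  unique : Unique (c ∷ deduplicate _≟_ cs)
  unique = All.tabulate (λ d∈ c≡d → c∉cs (subst (_∈ cs) (sym c≡d) (∈-deduplicate⁻ _≟_ cs d∈)))
         ∷ deduplicate-! _≟_ cs
  ⊆ds : c ∷ deduplicate _≟_ cs ⊆ deduplicate _≟_ _
  ⊆ds (here refl) = ∈-deduplicate⁺ _≟_ (c∷cs⊆ds (here refl))
  ⊆ds (there d∈) = ∈-deduplicate⁺ _≟_ (c∷cs⊆ds (there (∈-deduplicate⁻ _≟_ cs d∈)))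

distinct-⊆∷ : {c : ℕ} {cs ds : List ℕ} → cs ⊆ c ∷ ds → distinct cs ≤ suc (distinct ds)
distinct-⊆∷ {c} {cs} {ds} cs⊆c∷ds = Unique-⊆⇒length≤ (deduplicate-! _≟_ cs) ⊆c∷
  where
  ⊆c∷ : deduplicate _≟_ cs ⊆ c ∷ deduplicate _≟_ ds
  ⊆c∷ d∈ with cs⊆c∷ds (∈-deduplicate⁻ _≟_ cs d∈)
  ... | here d≡c = here d≡c
  ... | there d∈ds = there (∈-deduplicate⁺ _≟_ d∈ds)

2≤distinct : {c d : ℕ} {cs : List ℕ} → c ∈ cs → d ∈ cs → c ≢ d → 2 ≤ distinct cs
2≤distinct c∈ d∈ c≢d = distinct-∷-fresh {cs = [ _ ]} (λ { (here c≡d) → c≢d c≡d })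
  λ { (here refl) → c∈ ; (there (here refl)) → d∈ }

∃-∉ : {cs : List ℕ} (ds : List ℕ) → Unique cs → length ds < length cs → ∃[ c ] c ∈ cs × c ∉ ds
∃-∉ {cs} ds ucs ds<cs with all? (_∈? ds) cs
... | yes cs⊆ds = ⊥-elim (<⇒≱ ds<cs (Unique-⊆⇒length≤ ucs (All.lookup cs⊆ds)))
... | no cs⊈ds = find (¬All⇒Any¬ (_∈? ds) cs cs⊈ds)

𝟙 : Bool → ℕ
𝟙 true = 1
𝟙 false = 0

∑ : {A : Set} → (A → ℕ) → List A → ℕ
∑ f [] = 0
∑ f (x ∷ xs) = f x + ∑ f xs

infix 5 ∑
syntax ∑ (λ x → e) xs = ∑[ x ← xs ] e

if-1-0 : (b : Bool) → (if b then 1 else 0) ≡ 𝟙 b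
if-1-0 true = refl
if-1-0 false = refl

if-∧ : (b c : Bool) (m : ℕ) → (if b then (if c then m else 0) else 0) ≡ (if b ∧ c then m else 0)
if-∧ true c m = refl
if-∧ false c m = refl

module _ {A : Set} where

  ∑-cong : {f g : A → ℕ} (xs : List A) → (∀ x → f x ≡ g x) → ∑ f xs ≡ ∑ g xs
  ∑-cong [] _ = refl
  ∑-cong (x ∷ xs) f≗g = cong₂ _+_ (f≗g x) (∑-cong xs f≗g)

  ∑-mono : {f g : A → ℕ} (xs : List A) → (∀ x → x ∈ xs → f x ≤ g x) → ∑ f xs ≤ ∑ g xs
  ∑-mono [] _ = z≤n
  ∑-mono (x ∷ xs) f≤g = +-mono-≤ (f≤g x (here refl)) (∑-mono xs (λ y y∈ → f≤g y (there y∈)))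

  ∑-zero : (xs : List A) → ∑[ x ← xs ] 0 ≡ 0
  ∑-zero [] = refl
  ∑-zero (x ∷ xs) = ∑-zero xs

  ∑-+ : (f g : A → ℕ) (xs : List A) → ∑[ x ← xs ] (f x + g x) ≡ ∑ f xs + ∑ g xs
  ∑-+ f g [] = refl
  ∑-+ f g (x ∷ xs) = trans (cong (f x + g x +_) (∑-+ f g xs)) (interchange +-commutativeSemigroup (f x) (g x) (∑ f xs) (∑ g xs))

  ∑-*ˡ : (k : ℕ) (f : A → ℕ) (xs : List A) → ∑[ x ← xs ] (k * f x) ≡ k * ∑ f xs
  ∑-*ˡ k f [] = sym (*-zeroʳ k)
  ∑-*ˡ k f (x ∷ xs) = trans (cong (k * f x +_) (∑-*ˡ k f xs)) (sym (*-distribˡ-+ k (f x) (∑ f xs)))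

  ∑-if : (b : Bool) (f : A → ℕ) (xs : List A) →
         (if b then ∑ f xs else 0) ≡ ∑[ x ← xs ] (if b then f x else 0)
  ∑-if true f xs = refl
  ∑-if false f xs = sym (∑-zero xs)

  ∑-filter : {P : A → Set} (P? : ∀ x → Dec (P x)) (f : A → ℕ) (xs : List A) →
             ∑ f (filter P? xs) ≡ ∑[ x ← xs ] (if does (P? x) then f x else 0)
  ∑-filter P? f [] = refl
  ∑-filter P? f (x ∷ xs) with does (P? x)
  ... | true = cong (f x +_) (∑-filter P? f xs)
  ... | false = ∑-filter P? f xs

  ∑-const : (k : ℕ) (xs : List A) → ∑[ x ← xs ] k ≡ k * length xs
  ∑-const k [] = sym (*-zeroʳ k)
  ∑-const k (x ∷ xs) = trans (cong (k +_) (∑-const k xs)) (sym (*-suc k (length xs)))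

  length≡∑ : (xs : List A) → length xs ≡ ∑[ x ← xs ] 1
  length≡∑ [] = refl
  length≡∑ (x ∷ xs) = cong suc (length≡∑ xs)

  length-filter≡∑ : {P : A → Set} (P? : ∀ x → Dec (P x)) (xs : List A) →
                    length (filter P? xs) ≡ ∑[ x ← xs ] 𝟙 (does (P? x))
  length-filter≡∑ P? xs =
    trans (length≡∑ (filter P? xs)) (trans (∑-filter P? (λ _ → 1) xs) (∑-cong xs λ x → if-1-0 (does (P? x))))

  length-concatMap≡∑ : {B : Set} (f : A → List B) (xs : List A) → length (concatMap f xs) ≡ ∑[ x ← xs ] length (f x)
  length-concatMap≡∑ f [] = refl
  length-concatMap≡∑ f (x ∷ xs) = trans (length-++ (f x)) (cong (length (f x) +_) (length-concatMap≡∑ f xs))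

∑-swap : {A B : Set} (f : A → B → ℕ) (xs : List A) (ys : List B) →
         ∑[ x ← xs ] ∑[ y ← ys ] f x y ≡ ∑[ y ← ys ] ∑[ x ← xs ] f x y
∑-swap f [] ys = sym (∑-zero ys)
∑-swap f (x ∷ xs) ys = trans (cong (∑ (f x) ys +_) (∑-swap f xs ys)) (sym (∑-+ (f x) _ ys))

length-filter+length-filter-∁ : {A : Set} {P : A → Set} (P? : ∀ x → Dec (P x)) (xs : List A) →
                                length (filter P? xs) + length (filter (∁? P?) xs) ≡ length xs
length-filter+length-filter-∁ P? [] = refl
length-filter+length-filter-∁ P? (x ∷ xs) with P? x
... | yes _ = cong suc (length-filter+length-filter-∁ P? xs)
... | no _ = trans (+-suc _ _) (cong suc (length-filter+length-filter-∁ P? xs))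

∑-ordered-pairs : {m : ℕ} (F : Fin m → Fin m → Bool) → (∀ u v → F u v ≡ F v u) → (∀ u → F u u ≡ false) →
                  ∑[ u ← allFin m ] ∑[ v ← allFin m ] 𝟙 (F u v)
                  ≡ 2 * (∑[ u ← allFin m ] ∑[ v ← allFin m ] (if does (u <ᶠ? v) then 𝟙 (F u v) else 0))
∑-ordered-pairs {m} F F-sym F-irrefl = begin
  ∑[ u ← all ] ∑[ v ← all ] 𝟙 (F u v)
    ≡⟨ ∑-cong all (λ u → trans (∑-cong all (split u)) (∑-+ _ _ all)) ⟩
  ∑[ u ← all ] ((∑[ v ← all ] O u v) + (∑[ v ← all ] O′ u v))
    ≡⟨ ∑-+ _ _ all ⟩
  E + (∑[ u ← all ] ∑[ v ← all ] O′ u v)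
    ≡⟨ cong (E +_) (∑-swap O′ all all) ⟩
  E + (∑[ v ← all ] ∑[ u ← all ] O′ u v)
    ≡⟨ cong (E +_) (∑-cong all λ v → ∑-cong all λ u → cong (λ b → if does (v <ᶠ? u) then 𝟙 b else 0) (F-sym u v)) ⟩
  E + E
    ≡⟨ cong (E +_) (+-identityʳ E) ⟨
  2 * E
    ∎
  where
  open ≡-Reasoning
  all : List (Fin m)
  all = allFin m
  O O′ : Fin m → Fin m → ℕ
  O u v = if does (u <ᶠ? v) then 𝟙 (F u v) else 0
  O′ u v = if does (v <ᶠ? u) then 𝟙 (F u v) else 0
  E : ℕ
  E = ∑[ u ← all ] ∑[ v ← all ] O u v
  split : ∀ u v → 𝟙 (F u v) ≡ O u v + O′ u v
  split u v = by-cases (u <ᶠ? v) (v <ᶠ? u) (<ᶠ-cmp u v)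
    where
    by-cases : (d : Dec (u <ᶠ v)) (d′ : Dec (v <ᶠ u)) → Tri (u <ᶠ v) (u ≡ v) (v <ᶠ u) →
               𝟙 (F u v) ≡ (if does d then 𝟙 (F u v) else 0) + (if does d′ then 𝟙 (F u v) else 0)
    by-cases (yes u<v) (yes v<u) _ = ⊥-elim (<ᶠ-asym u<v v<u)
    by-cases (yes _) (no _) _ = sym (+-identityʳ _)
    by-cases (no _) (yes _) _ = refl
    by-cases (no u≮v) (no _) (tri< u<v _ _) = ⊥-elim (u≮v u<v)
    by-cases (no _) (no v≮u) (tri> _ _ v<u) = ⊥-elim (v≮u v<u)
    by-cases (no _) (no _) (tri≈ _ refl _) rewrite F-irrefl u = refl

∧-true : {a b : Bool} → a ∧ b ≡ true → a ≡ true × b ≡ true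
∧-true {true} {true} _ = refl , refl

∧-mirror : (a b c : Bool) → b ∧ (a ∧ c) ≡ c ∧ (a ∧ b)
∧-mirror a true true = refl
∧-mirror a true false = ∧-zeroʳ a
∧-mirror a false true = sym (∧-zeroʳ a)
∧-mirror a false false = refl

does-≟-true : (b : Bool) → does (b ≟ᵇ true) ≡ b
does-≟-true true = refl
does-≟-true false = refl

dynamic-≤1 : {A : Set} (r : ℕ) (φ : A → ℕ) (xs : List A) → length xs ≤ 1 → r ⊓ length xs ≤ distinct (map φ xs)
dynamic-≤1 r φ [] _ = ≤-reflexive (⊓-zeroʳ r)
dynamic-≤1 r φ (x ∷ []) _ = m⊓n≤n r 1
dynamic-≤1 r φ (x ∷ y ∷ xs) (s≤s ())

module Induced (G : Graph) where

  open import Data.List.Membership.DecPropositional (_≟ᶠ_ {n G}) using () renaming (_∈?_ to _∈ᵛ?_)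

  V : Set
  V = Fin (n G)

  VertexSet : Set
  VertexSet = V → Bool

  vertices : List V
  vertices = allFin (n G)

  members : VertexSet → List V
  members C = filter (λ u → C u ≟ᵇ true) vertices

  size : VertexSet → ℕ
  size C = length (members C)

  nbr : VertexSet → V → List V
  nbr C v = filter (λ u → adj G v u ∧ C u ≟ᵇ true) vertices

  degIn : VertexSet → V → ℕ
  degIn C v = length (nbr C v)

  colours : VertexSet → (V → ℕ) → V → List ℕ
  colours C φ v = map φ (nbr C v)

  adj⇒≢ : {u v : V} → adj G u v ≡ true → u ≢ v
  adj⇒≢ {u} uv refl with () ← trans (sym uv) (irrefl G u)

  nbr-∈⁺ : {C : VertexSet} {u v : V} → adj G v u ≡ true → C u ≡ true → u ∈ nbr C v
  nbr-∈⁺ {C} {u} {v} vu Cu =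
    ∈-filter⁺ (λ w → adj G v w ∧ C w ≟ᵇ true) (∈-allFin u) (subst₂ (λ a b → a ∧ b ≡ true) (sym vu) (sym Cu) refl)

  nbr-∈⁻ : {C : VertexSet} {u v : V} → u ∈ nbr C v → adj G v u ≡ true × C u ≡ true
  nbr-∈⁻ {C} {u} {v} u∈ = ∧-true (proj₂ (∈-filter⁻ (λ w → adj G v w ∧ C w ≟ᵇ true) {xs = vertices} u∈))

  nbr-unique : (C : VertexSet) (v : V) → Unique (nbr C v)
  nbr-unique C v = filter⁺ (λ u → adj G v u ∧ C u ≟ᵇ true) (allFin⁺ (n G))

  nbr-cong : {C D : VertexSet} {v : V} → (∀ u → adj G v u ≡ true → C u ≡ D u) → nbr C v ≡ nbr D v
  nbr-cong {C} {D} {v} C≗D = filter-≐ (λ u → adj G v u ∧ C u ≟ᵇ true) (λ u → adj G v u ∧ D u ≟ᵇ true)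
    (transfer C≗D , transfer (λ u vu → sym (C≗D u vu))) vertices
    where
    transfer : {C D : VertexSet} → (∀ u → adj G v u ≡ true → C u ≡ D u) →
               ∀ {u} → adj G v u ∧ C u ≡ true → adj G v u ∧ D u ≡ true
    transfer C≗D {u} vuCu = let vu , _ = ∧-true vuCu in trans (cong (adj G v u ∧_) (sym (C≗D u vu))) vuCu

  _∖_ : VertexSet → List V → VertexSet
  (C ∖ zs) u = C u ∧ not (does (u ∈ᵛ? zs))

  insert : V → VertexSet → VertexSet
  insert z D u = D u ∨ does (u ≟ᶠ z)

  _[_↦_] : (V → ℕ) → V → ℕ → V → ℕ
  (φ [ z ↦ a ]) u = if does (u ≟ᶠ z) then a else φ u

  ∖-⊆ : {C : VertexSet} {zs : List V} {u : V} → (C ∖ zs) u ≡ true → C u ≡ true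
  ∖-⊆ = proj₁ ∘ ∧-true

  ∖-unchanged : {C : VertexSet} {zs : List V} {u : V} → (C u ≡ true → u ∉ zs) → (C ∖ zs) u ≡ C u
  ∖-unchanged {C} {zs} {u} u∉zs with u ∈ᵛ? zs
  ... | no _ = ∧-identityʳ (C u)
  ... | yes u∈zs with C u
  ...   | true = ⊥-elim (u∉zs refl u∈zs)
  ...   | false = refl

  ∖-intro : {C : VertexSet} {zs : List V} {u : V} → C u ≡ true → u ∉ zs → (C ∖ zs) u ≡ true
  ∖-intro {C} {zs} Cu u∉zs = trans (∖-unchanged {C} {zs} (λ _ → u∉zs)) Cu

  nbr-∖-self : {C : VertexSet} {v : V} → nbr (C ∖ [ v ]) v ≡ nbr C v
  nbr-∖-self {C} {v} = nbr-cong λ u vu → ∖-unchanged {C} {[ v ]} (λ { _ (here refl) → adj⇒≢ vu refl })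

  ∖-removes : {C : VertexSet} {zs : List V} {u : V} → u ∈ zs → (C ∖ zs) u ≡ false
  ∖-removes {C} {zs} {u} u∈zs with u ∈ᵛ? zs
  ... | yes _ = ∧-zeroʳ (C u)
  ... | no u∉zs = ⊥-elim (u∉zs u∈zs)

  ∖-excludes : {C : VertexSet} {zs : List V} {u : V} → (C ∖ zs) u ≡ true → u ∉ zs
  ∖-excludes {C} {zs} Cu u∈zs with () ← trans (sym (∖-removes {C} u∈zs)) Cu

  ∖-[] : (C : VertexSet) (u : V) → (C ∖ []) u ≡ C u
  ∖-[] C u = ∧-identityʳ (C u)

  insert-∖ : {C : VertexSet} {z : V} {zs : List V} → C z ≡ true → z ∉ zs →
             ∀ u → insert z (C ∖ (z ∷ zs)) u ≡ (C ∖ zs) u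
  insert-∖ {C} {z} {zs} Cz z∉zs u with u ≟ᶠ z
  ... | yes refl = trans (∨-zeroʳ _) (sym (∖-intro {C} Cz z∉zs))
  ... | no u≢z with u ∈ᵛ? z ∷ zs | u ∈ᵛ? zs
  ...   | yes (here u≡z) | _ = ⊥-elim (u≢z u≡z)
  ...   | yes (there u∈zs) | no u∉zs = ⊥-elim (u∉zs u∈zs)
  ...   | yes (there _) | yes _ = ∨-identityʳ _
  ...   | no u∉z∷zs | yes u∈zs = ⊥-elim (u∉z∷zs (there u∈zs))
  ...   | no _ | no _ = ∨-identityʳ _

  insert-new : {D : VertexSet} (z : V) → insert z D z ≡ true
  insert-new {D} z with z ≟ᶠ z
  ... | yes _ = ∨-zeroʳ (D z)
  ... | no z≢z = ⊥-elim (z≢z refl)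

  insert-old : {D : VertexSet} {z u : V} → D u ≡ true → insert z D u ≡ true
  insert-old Du rewrite Du = refl

  insert-inv : {D : VertexSet} {z u : V} → insert z D u ≡ true → D u ≡ true ⊎ u ≡ z
  insert-inv {D} {z} {u} e with D u | u ≟ᶠ z
  ... | true | _ = inj₁ refl
  ... | false | yes u≡z = inj₂ u≡z

  update-≡ : (φ : V → ℕ) (z : V) (a : ℕ) → (φ [ z ↦ a ]) z ≡ a
  update-≡ φ z a with z ≟ᶠ z
  ... | yes _ = refl
  ... | no z≢z = ⊥-elim (z≢z refl)

  update-≢ : (φ : V → ℕ) {z : V} (a : ℕ) {u : V} → u ≢ z → (φ [ z ↦ a ]) u ≡ φ u
  update-≢ φ {z} a {u} u≢z with u ≟ᶠ z
  ... | yes u≡z = ⊥-elim (u≢z u≡z)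
  ... | no _ = refl

  member : {C : VertexSet} {u : V} → C u ≡ true → u ∈ members C
  member {C} {u} Cu = ∈-filter⁺ (λ w → C w ≟ᵇ true) (∈-allFin u) Cu

  member⁻ : {C : VertexSet} {u : V} → u ∈ members C → C u ≡ true
  member⁻ {C} u∈ = proj₂ (∈-filter⁻ (λ w → C w ≟ᵇ true) {xs = vertices} u∈)

  size-∖ : {C : VertexSet} {v : V} {zs : List V} → C v ≡ true → v ∈ zs → size (C ∖ zs) < size C
  size-∖ {C} {v} {zs} Cv v∈zs = Unique-⊆⇒length≤ (v∉ ∷ filter⁺ _ (allFin⁺ (n G))) ⊆members
    where
    v∉ : All (v ≢_) (members (C ∖ zs))
    v∉ = All.tabulate λ { u∈ refl → case trans (sym (∖-removes {C} v∈zs)) (member⁻ u∈) of λ () }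
    ⊆members : v ∷ members (C ∖ zs) ⊆ members C
    ⊆members (here refl) = member Cv
    ⊆members (there u∈) = member (∖-⊆ {C} {zs} (member⁻ u∈))

  nbr-insert-nonadj : {D : VertexSet} {z x : V} → adj G x z ≡ false → nbr (insert z D) x ≡ nbr D x
  nbr-insert-nonadj {D} {z} {x} xz = nbr-cong unchanged
    where
    unchanged : ∀ u → adj G x u ≡ true → insert z D u ≡ D u
    unchanged u xu with u ≟ᶠ z
    ... | yes refl with () ← trans (sym xz) xu
    ... | no _ = ∨-identityʳ (D u)

  degIn-insert : {D : VertexSet} {z x : V} → D z ≡ false → adj G x z ≡ true →
                 degIn (insert z D) x ≡ suc (degIn D x)
  degIn-insert {D} {z} {x} Dz xz = Unique-⊆⊇⇒length≡ (nbr-unique (insert z D) x) (z∉ ∷ nbr-unique D x) ⊆z∷ ⊇z∷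
    where
    z∉ : All (z ≢_) (nbr D x)
    z∉ = All.tabulate λ { u∈ refl → case trans (sym Dz) (proj₂ (nbr-∈⁻ u∈)) of λ () }
    ⊆z∷ : nbr (insert z D) x ⊆ z ∷ nbr D x
    ⊆z∷ u∈ with nbr-∈⁻ {insert z D} u∈
    ... | xu , zDu with insert-inv {D} zDu
    ...   | inj₁ Du = there (nbr-∈⁺ xu Du)
    ...   | inj₂ refl = here refl
    ⊇z∷ : z ∷ nbr D x ⊆ nbr (insert z D) x
    ⊇z∷ (here refl) = nbr-∈⁺ xz (insert-new {D} z)
    ⊇z∷ (there u∈) = let xu , Du = nbr-∈⁻ u∈ in nbr-∈⁺ xu (insert-old {D} Du)

  degIn-∖ : {C : VertexSet} {z x : V} → C z ≡ true → adj G x z ≡ true → degIn C x ≡ suc (degIn (C ∖ [ z ]) x)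
  degIn-∖ {C} {z} {x} Cz xz = begin
    degIn C x
      ≡⟨ cong length (nbr-cong (λ u _ → trans (sym (∖-[] C u)) (sym (insert-∖ {C} {zs = []} Cz (λ ()) u)))) ⟩
    degIn (insert z (C ∖ [ z ])) x
      ≡⟨ degIn-insert (∖-removes {C} {[ z ]} (here refl)) xz ⟩
    suc (degIn (C ∖ [ z ]) x)
      ∎
    where open ≡-Reasoning

  colours-update : {D : VertexSet} {φ : V → ℕ} {z x : V} (a : ℕ) → z ∉ nbr D x →
                   colours D (φ [ z ↦ a ]) x ≡ colours D φ x
  colours-update {φ = φ} a z∉ = map-cong-local (All.tabulate λ u∈ → update-≢ φ a λ { refl → z∉ u∈ })

  update-proper : {C : VertexSet} {φ : V → ℕ} {z : V} {a : ℕ} →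
                  (∀ u v → C u ≡ true → C v ≡ true → adj G u v ≡ true → u ≢ z → v ≢ z → φ u ≢ φ v) →
                  (∀ v → C v ≡ true → adj G z v ≡ true → a ≢ φ v) →
                  ∀ u v → C u ≡ true → C v ≡ true → adj G u v ≡ true → (φ [ z ↦ a ]) u ≢ (φ [ z ↦ a ]) v
  update-proper {z = z} proper a-fresh u v Cu Cv uv with u ≟ᶠ z | v ≟ᶠ z
  ... | yes refl | yes refl = λ _ → adj⇒≢ uv refl
  ... | yes refl | no _ = a-fresh v Cv uv
  ... | no _ | yes refl = a-fresh u Cu (trans (Defs.sym G z u) uv) ∘ sym
  ... | no u≢z | no v≢z = proper u v Cu Cv uv u≢z v≢z

  update-fromLists : {C : VertexSet} {φ : V → ℕ} {z : V} {a : ℕ} (L : ListAssignment G) →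
                     (∀ v → C v ≡ true → v ≢ z → φ v ∈ L v) → a ∈ L z →
                     ∀ v → C v ≡ true → (φ [ z ↦ a ]) v ∈ L v
  update-fromLists {z = z} L fromLists a∈Lz v Cv with v ≟ᶠ z
  ... | yes refl = a∈Lz
  ... | no v≢z = fromLists v Cv v≢z

module Colouring (G : Graph) (L : ListAssignment G) (r : ℕ) where

  open Induced G

  record DynamicOn (C : VertexSet) (φ : V → ℕ) : Set where
    field
      fromLists : ∀ v → C v ≡ true → φ v ∈ L v
      proper    : ∀ u v → C u ≡ true → C v ≡ true → adj G u v ≡ true → φ u ≢ φ v
      dynamic   : ∀ v → C v ≡ true → r ⊓ degIn C v ≤ distinct (colours C φ v)

  open DynamicOn

  DynamicOn-cong : {C D : VertexSet} {φ : V → ℕ} → (∀ u → C u ≡ D u) → DynamicOn C φ → DynamicOn D φ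
  DynamicOn-cong {C} {D} {φ} C≗D col = record
    { fromLists = λ v Dv → fromLists col v (trans (C≗D v) Dv)
    ; proper    = λ u v Du Dv → proper col u v (trans (C≗D u) Du) (trans (C≗D v) Dv)
    ; dynamic   = λ v Dv → subst (λ ns → r ⊓ length ns ≤ distinct (map φ ns)) (nbr-cong (λ u _ → C≗D u))
                                 (dynamic col v (trans (C≗D v) Dv))
    }

  DynamicOn-∅ : {C : VertexSet} (φ : V → ℕ) → (∀ v → C v ≡ false) → DynamicOn C φ
  DynamicOn-∅ {C} φ C≡∅ = record
    { fromLists = λ v Cv → absurd v Cv
    ; proper    = λ u _ Cu _ _ → absurd u Cu
    ; dynamic   = λ v Cv → absurd v Cv
    }
    where
    absurd : ∀ {A : Set} v → C v ≡ true → A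
    absurd v Cv with () ← trans (sym (C≡∅ v)) Cv

  dynamic-2-vertex : {D : VertexSet} {φ : V → ℕ} {x u w : V} → degIn D x ≡ 2 → u ∈ nbr D x → w ∈ nbr D x →
                     φ u ≢ φ w → r ⊓ degIn D x ≤ distinct (colours D φ x)
  dynamic-2-vertex {D} {φ} {x} d≡2 u∈ w∈ φu≢φw =
    ≤-trans (≤-trans (m⊓n≤n r (degIn D x)) (≤-reflexive d≡2)) (2≤distinct (∈-map⁺ φ u∈) (∈-map⁺ φ w∈) φu≢φw)

  blockedBy : VertexSet → (V → ℕ) → V → List ℕ
  blockedBy D φ x with r ≤? distinct (colours D φ x)
  ... | yes _ = []
  ... | no _ = deduplicate _≟_ (colours D φ x)

  -- The colours of a neighbour x of z are counted in G[D]: D = C when z is new, and D = C ∖ [ z ]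
  -- when z is recoloured, since z's old colour is then lost to x.
  forbidden : VertexSet → VertexSet → (V → ℕ) → V → List ℕ
  forbidden C D φ z = colours C φ z ++ concatMap (blockedBy D φ) (nbr C z)

  length-blockedBy : (D : VertexSet) (φ : V → ℕ) (x : V) → length (blockedBy D φ x) ≤ pred r
  length-blockedBy D φ x with r ≤? distinct (colours D φ x)
  ... | yes _ = z≤n
  ... | no r≰ = suc[m]≤n⇒m≤pred[n] (≰⇒> r≰)

  length-forbidden : (C D : VertexSet) (φ : V → ℕ) (z : V) →
                     length (forbidden C D φ z) ≤ degIn C z + pred r * degIn C z
  length-forbidden C D φ z = begin
    length (forbidden C D φ z)
      ≡⟨ length-++ (colours C φ z) ⟩
    length (colours C φ z) + length (concatMap (blockedBy D φ) (nbr C z))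
      ≡⟨ cong₂ _+_ (length-map φ (nbr C z)) (length-concatMap≡∑ _ (nbr C z)) ⟩
    degIn C z + (∑[ x ← nbr C z ] length (blockedBy D φ x))
      ≤⟨ +-monoʳ-≤ (degIn C z) (∑-mono (nbr C z) (λ x _ → length-blockedBy D φ x)) ⟩
    degIn C z + (∑[ x ← nbr C z ] pred r)
      ≡⟨ cong (degIn C z +_) (∑-const (pred r) (nbr C z)) ⟩
    degIn C z + pred r * degIn C z
      ∎
    where open ≤-Reasoning

  avoids-colours : {C D : VertexSet} {φ : V → ℕ} {z : V} {a : ℕ} {v : V} →
                   a ∉ forbidden C D φ z → C v ≡ true → adj G z v ≡ true → a ≢ φ v
  avoids-colours {C} {φ = φ} {z} a∉ Cv zv refl = a∉ (∈-++⁺ˡ (∈-map⁺ φ (nbr-∈⁺ zv Cv)))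

  avoids-blocked : {C D : VertexSet} {φ : V → ℕ} {z : V} {a : ℕ} {x : V} →
                   a ∉ forbidden C D φ z → x ∈ nbr C z → r ≤ distinct (colours D φ x) ⊎ a ∉ colours D φ x
  avoids-blocked {C} {D} {φ} {z} {a} {x} a∉ x∈ with r ≤? distinct (colours D φ x) in eq
  ... | yes r≤ = inj₁ r≤
  ... | no _ = inj₂ λ a∈ →
    a∉ (∈-++⁺ʳ (colours C φ z) (∈-concatMap⁺ (blockedBy D φ) (Any.map (λ { refl → blocked a∈ }) x∈)))
    where
    blocked : a ∈ colours D φ x → a ∈ blockedBy D φ x
    blocked a∈ rewrite eq = ∈-deduplicate⁺ _≟_ a∈

  gain-colour : {k a : ℕ} {cs ds : List ℕ} → r ⊓ k ≤ suc (distinct cs) → r ≤ distinct cs ⊎ a ∉ cs → a ∷ cs ⊆ ds →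
         r ⊓ k ≤ distinct ds
  gain-colour {k} _ (inj₁ r≤) ⊆ds = ≤-trans (m⊓n≤m r k) (≤-trans r≤ (distinct-mono (⊆ds ∘ there)))
  gain-colour k≤ (inj₂ a∉) ⊆ds = ≤-trans k≤ (distinct-∷-fresh a∉ ⊆ds)

  extend : {D : VertexSet} {φ : V → ℕ} {z : V} {a : ℕ} →
           DynamicOn D φ → D z ≡ false → a ∈ L z → a ∉ forbidden D D φ z →
           r ⊓ degIn D z ≤ distinct (colours D φ z) → DynamicOn (insert z D) (φ [ z ↦ a ])
  extend {D} {φ} {z} {a} col Dz a∈Lz a∉ dynamic-z = record
    { fromLists = update-fromLists L (λ v zDv v≢z → fromLists col v (old zDv v≢z)) a∈Lz
    ; proper    = update-proper (λ u v zDu zDv uv u≢z v≢z → proper col u v (old zDu u≢z) (old zDv v≢z) uv)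
                                (λ v zDv zv → avoids-colours a∉ (old zDv (adj⇒≢ zv ∘ sym)) zv)
    ; dynamic   = dyn
    }
    where
    old : ∀ {v} → insert z D v ≡ true → v ≢ z → D v ≡ true
    old {v} zDv v≢z with insert-inv {D} zDv
    ... | inj₁ Dv = Dv
    ... | inj₂ v≡z = ⊥-elim (v≢z v≡z)
    z∉nbr : ∀ {x} → z ∉ nbr D x
    z∉nbr z∈ with () ← trans (sym Dz) (proj₂ (nbr-∈⁻ z∈))
    unchanged : ∀ x → colours D (φ [ z ↦ a ]) x ≡ colours D φ x
    unchanged x = colours-update a z∉nbr
    dyn : ∀ x → insert z D x ≡ true → r ⊓ degIn (insert z D) x ≤ distinct (colours (insert z D) (φ [ z ↦ a ]) x)
    dyn x zDx with adj G x z in xz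
    ... | false rewrite nbr-insert-nonadj {D} xz | unchanged x with insert-inv {D} zDx
    ...   | inj₁ Dx = dynamic col x Dx
    ...   | inj₂ refl = dynamic-z
    dyn x zDx | true with insert-inv {D} zDx
    ...   | inj₂ refl = ⊥-elim (adj⇒≢ xz refl)
    ...   | inj₁ Dx rewrite degIn-insert {D} Dz xz =
      gain-colour (≤-trans (⊓-monoˡ-≤ (suc (degIn D x)) (n≤1+n r)) (s≤s (dynamic col x Dx)))
           (avoids-blocked a∉ (nbr-∈⁺ (trans (Defs.sym G z x) xz) Dx)) new
      where
      new : a ∷ colours D φ x ⊆ colours (insert z D) (φ [ z ↦ a ]) x
      new (here refl) = subst (_∈ colours (insert z D) (φ [ z ↦ a ]) x) (update-≡ φ z a)
                              (∈-map⁺ (φ [ z ↦ a ]) (nbr-∈⁺ xz (insert-new {D} z)))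
      new (there c∈) with u , u∈ , refl ← ∈-map⁻ φ c∈ =
        let xu , Du = nbr-∈⁻ u∈ in
        subst (_∈ colours (insert z D) (φ [ z ↦ a ]) x) (update-≢ φ a (λ { refl → z∉nbr u∈ }))
              (∈-map⁺ (φ [ z ↦ a ]) (nbr-∈⁺ xu (insert-old {D} Du)))

  recolour : {C : VertexSet} {φ : V → ℕ} {z : V} {a : ℕ} →
             DynamicOn C φ → C z ≡ true → a ∈ L z → a ∉ forbidden C (C ∖ [ z ]) φ z →
             DynamicOn C (φ [ z ↦ a ])
  recolour {C} {φ} {z} {a} col Cz a∈Lz a∉ = record
    { fromLists = update-fromLists L (λ v Cv _ → fromLists col v Cv) a∈Lz
    ; proper    = update-proper (λ u v Cu Cv uv _ _ → proper col u v Cu Cv uv) (λ v Cv zv → avoids-colours a∉ Cv zv)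
    ; dynamic   = dyn
    }
    where
    R : VertexSet
    R = C ∖ [ z ]
    dyn : ∀ x → C x ≡ true → r ⊓ degIn C x ≤ distinct (colours C (φ [ z ↦ a ]) x)
    dyn x Cx with adj G x z in xz
    ... | false rewrite colours-update {C} {φ} {z} {x} a (λ z∈ → case trans (sym xz) (proj₁ (nbr-∈⁻ z∈)) of λ ()) =
      dynamic col x Cx
    ... | true = gain-colour (≤-trans (dynamic col x Cx) (distinct-⊆∷ old))
                             (avoids-blocked a∉ (nbr-∈⁺ (trans (Defs.sym G z x) xz) Cx)) new
      where
      z∉R : ∀ {u} → u ∈ nbr R x → u ≢ z
      z∉R u∈ refl with () ← trans (sym (∖-removes {C} {[ z ]} (here refl))) (proj₂ (nbr-∈⁻ u∈))
      old : colours C φ x ⊆ φ z ∷ colours R φ x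
      old c∈ with u , u∈ , refl ← ∈-map⁻ φ c∈ with u ≟ᶠ z
      ... | yes refl = here refl
      ... | no u≢z = let xu , Cu = nbr-∈⁻ u∈ in
        there (∈-map⁺ φ (nbr-∈⁺ xu (∖-intro {C} {[ z ]} Cu λ { (here u≡z) → u≢z u≡z })))
      new : a ∷ colours R φ x ⊆ colours C (φ [ z ↦ a ]) x
      new (here refl) = subst (_∈ colours C (φ [ z ↦ a ]) x) (update-≡ φ z a) (∈-map⁺ (φ [ z ↦ a ]) (nbr-∈⁺ xz Cz))
      new (there c∈) with u , u∈ , refl ← ∈-map⁻ φ c∈ =
        let xu , Ru = nbr-∈⁻ u∈ in
        subst (_∈ colours C (φ [ z ↦ a ]) x) (update-≢ φ a (z∉R u∈))
              (∈-map⁺ (φ [ z ↦ a ]) (nbr-∈⁺ xu (∖-⊆ {C} {[ z ]} Ru)))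

module Discharging (G : Graph) where

  open Induced G

  induced : VertexSet → Subgraph G
  induced C = record
    { S      = C
    ; F      = λ u v → C u ∧ (adj G u v ∧ C v)
    ; F⊆adj  = λ u v e → proj₁ (∧-true {adj G u v} (proj₂ (∧-true {C u} e)))
    ; F-sym  = λ u v → trans (cong (λ a → C u ∧ (a ∧ C v)) (Defs.sym G u v)) (∧-mirror (adj G v u) (C u) (C v))
    ; F-in-S = λ u v e → proj₁ (∧-true {C u} e) , proj₂ (∧-true {adj G u v} (proj₂ (∧-true {C u} e)))
    }

  twoNbrs bigNbrs : VertexSet → V → List V
  twoNbrs C v = filter (λ u → degIn C u ≟ 2) (nbr C v)
  bigNbrs C v = filter (∁? (λ u → degIn C u ≟ 2)) (nbr C v)

  ∑-filter-true : (p : V → Bool) (f : V → ℕ) →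
                  ∑ f (filter (λ u → p u ≟ᵇ true) vertices) ≡ ∑[ u ← vertices ] (if p u then f u else 0)
  ∑-filter-true p f = trans (∑-filter (λ u → p u ≟ᵇ true) f vertices)
    (∑-cong vertices λ u → cong (λ b → if b then f u else 0) (does-≟-true (p u)))

  ∑-members : (C : VertexSet) (f : V → ℕ) → ∑ f (members C) ≡ ∑[ u ← vertices ] (if C u then f u else 0)
  ∑-members C = ∑-filter-true C

  ∑-nbr : (C : VertexSet) (f : V → ℕ) (v : V) → ∑ f (nbr C v) ≡ ∑[ u ← vertices ] (if adj G v u ∧ C u then f u else 0)
  ∑-nbr C f v = ∑-filter-true (λ u → adj G v u ∧ C u) f

  ∑-members-nbr : (C : VertexSet) (f : V → V → ℕ) →
                  ∑[ v ← members C ] ∑[ u ← nbr C v ] f v u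
                  ≡ ∑[ v ← vertices ] ∑[ u ← vertices ] (if C v ∧ (adj G v u ∧ C u) then f v u else 0)
  ∑-members-nbr C f = trans (∑-members C _) (∑-cong vertices λ v →
    trans (cong (λ n → if C v then n else 0) (∑-nbr C (f v) v))
          (trans (∑-if (C v) _ vertices) (∑-cong vertices λ u → if-∧ (C v) _ (f v u))))

  ∑-over-nbrs : (C : VertexSet) (f : V → ℕ) →
                ∑[ v ← members C ] ∑[ u ← nbr C v ] f u ≡ ∑[ u ← members C ] degIn C u * f u
  ∑-over-nbrs C f = begin
    ∑[ v ← members C ] ∑[ u ← nbr C v ] f u
      ≡⟨ ∑-members-nbr C (λ _ u → f u) ⟩
    ∑[ v ← vertices ] ∑[ u ← vertices ] (if C v ∧ (adj G v u ∧ C u) then f u else 0)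
      ≡⟨ ∑-swap _ vertices vertices ⟩
    ∑[ u ← vertices ] ∑[ v ← vertices ] (if C v ∧ (adj G v u ∧ C u) then f u else 0)
      ≡⟨ ∑-cong vertices (λ u → ∑-cong vertices λ v →
           cong (λ b → if b then f u else 0) (Subgraph.F-sym (induced C) v u)) ⟩
    ∑[ u ← vertices ] ∑[ v ← vertices ] (if C u ∧ (adj G u v ∧ C v) then f u else 0)
      ≡⟨ ∑-members-nbr C (λ u _ → f u) ⟨
    ∑[ u ← members C ] ∑[ v ← nbr C u ] f u
      ≡⟨ ∑-cong (members C) (λ u → trans (∑-const (f u) (nbr C u)) (*-comm (f u) (degIn C u))) ⟩
    ∑[ u ← members C ] degIn C u * f u
      ∎
    where open ≡-Reasoning

  handshake : (C : VertexSet) → ∑[ v ← members C ] degIn C v ≡ 2 * eCount (induced C)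
  handshake C = begin
    ∑[ v ← members C ] degIn C v
      ≡⟨ ∑-cong (members C) (λ v → length≡∑ (nbr C v)) ⟩
    ∑[ v ← members C ] ∑[ u ← nbr C v ] 1
      ≡⟨ ∑-members-nbr C (λ _ _ → 1) ⟩
    ∑[ v ← vertices ] ∑[ u ← vertices ] (if edge v u then 1 else 0)
      ≡⟨ ∑-cong vertices (λ v → ∑-cong vertices λ u → if-1-0 (edge v u)) ⟩
    ∑[ v ← vertices ] ∑[ u ← vertices ] 𝟙 (edge v u)
      ≡⟨ ∑-ordered-pairs edge (Subgraph.F-sym (induced C)) edge-irrefl ⟩
    2 * (∑[ v ← vertices ] ∑[ u ← vertices ] (if does (v <ᶠ? u) then 𝟙 (edge v u) else 0))
      ≡⟨ cong (2 *_) edges ⟨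
    2 * eCount (induced C)
      ∎
    where
    open ≡-Reasoning
    edge : V → V → Bool
    edge = Subgraph.F (induced C)
    edge-irrefl : ∀ u → edge u u ≡ false
    edge-irrefl u rewrite irrefl G u = ∧-zeroʳ (C u)
    edges : eCount (induced C) ≡ ∑[ v ← vertices ] ∑[ u ← vertices ] (if does (v <ᶠ? u) then 𝟙 (edge v u) else 0)
    edges = trans (length-concatMap≡∑ _ vertices) (∑-cong vertices λ v →
      trans (length-filter≡∑ (λ u → edge v u ≟ᵇ true) (filter (v <ᶠ?_) vertices))
            (trans (∑-filter (v <ᶠ?_) _ vertices)
                   (∑-cong vertices λ u → cong (λ b → if does (v <ᶠ? u) then 𝟙 b else 0) (does-≟-true (edge v u)))))

  ∑-twoNbrs : (C : VertexSet) →
              ∑[ v ← members C ] length (twoNbrs C v) ≡ 2 * (∑[ v ← members C ] 𝟙 (does (degIn C v ≟ 2)))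
  ∑-twoNbrs C = begin
    ∑[ v ← members C ] length (twoNbrs C v)
      ≡⟨ ∑-cong (members C) (λ v → length-filter≡∑ _ (nbr C v)) ⟩
    ∑[ v ← members C ] ∑[ u ← nbr C v ] 𝟙 (does (degIn C u ≟ 2))
      ≡⟨ ∑-over-nbrs C _ ⟩
    ∑[ u ← members C ] degIn C u * 𝟙 (does (degIn C u ≟ 2))
      ≡⟨ ∑-cong (members C) (λ u → twice (degIn C u)) ⟩
    ∑[ u ← members C ] 2 * 𝟙 (does (degIn C u ≟ 2))
      ≡⟨ ∑-*ˡ 2 _ (members C) ⟩
    2 * (∑[ v ← members C ] 𝟙 (does (degIn C v ≟ 2)))
      ∎
    where
    open ≡-Reasoning
    twice : ∀ d → d * 𝟙 (does (d ≟ 2)) ≡ 2 * 𝟙 (does (d ≟ 2))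
    twice d = by-cases (d ≟ 2)
      where
      by-cases : (d≟2 : Dec (d ≡ 2)) → d * 𝟙 (does d≟2) ≡ 2 * 𝟙 (does d≟2)
      by-cases (yes refl) = refl
      by-cases (no _) = *-zeroʳ d

  -- The final charge 2d − 6 − t + 2·[d = 2] of a d-vertex with t neighbours of degree 2 is non-negative.
  charge-balance : {d t : ℕ} → 2 ≤ d → (d ≤ 3 → t ≡ 0) → (d ≤ 5 → t + 2 ≤ d) → t ≤ d →
                   6 + t ≤ 2 * d + 2 * 𝟙 (does (d ≟ 2))
  charge-balance {1} (s≤s ())
  charge-balance {2} _ no-two _ _ rewrite no-two (s≤s (s≤s z≤n)) = ≤-refl
  charge-balance {3} _ no-two _ _ rewrite no-two ≤-refl = ≤-refl
  charge-balance {4} {t} _ _ two≤ _ = +-monoʳ-≤ 6 (+-cancelʳ-≤ 2 t 2 (two≤ (s≤s (s≤s (s≤s (s≤s z≤n))))))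
  charge-balance {5} {t} _ _ two≤ _ = ≤-trans (+-monoʳ-≤ 6 (+-cancelʳ-≤ 2 t 3 (two≤ ≤-refl))) (n≤1+n 9)
  charge-balance {d@(suc (suc (suc (suc (suc (suc _))))))} {t} _ _ _ t≤d = begin
    6 + t                ≤⟨ +-mono-≤ 6≤d t≤d ⟩
    d + d                ≡⟨ cong (d +_) (+-identityʳ d) ⟨
    2 * d                ≡⟨ +-identityʳ (2 * d) ⟨
    2 * d + 2 * 0        ∎
    where
    open ≤-Reasoning
    6≤d : 6 ≤ d
    6≤d = s≤s (s≤s (s≤s (s≤s (s≤s (s≤s z≤n)))))

  discharging : MadLessThan G 3 → {C : VertexSet} {v₀ : V} → C v₀ ≡ true →
                (∀ v → C v ≡ true → 2 ≤ degIn C v) →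
                (∀ v u → C v ≡ true → degIn C v ≡ 2 → u ∈ nbr C v → 4 ≤ degIn C u) →
                (∀ v → C v ≡ true → degIn C v ≤ 5 → 2 ≤ length (bigNbrs C v)) → ⊥
  discharging mad {C} {v₀} Cv₀ min-deg two-nbrs-big light-has-big = <⇒≱ sparse dense
    where
    M : List V
    M = members C
    E W : ℕ
    E = eCount (induced C)
    W = ∑[ v ← M ] 𝟙 (does (degIn C v ≟ 2))
    sparse : 2 * (2 * E) < 6 * size C
    sparse = subst (2 * (2 * E) <_) (sym (*-assoc 2 3 (size C)))
                   (*-monoʳ-< 2 (mad (induced C) (∈-length (member Cv₀))))
    balance : ∀ v → v ∈ M → 6 + length (twoNbrs C v) ≤ 2 * degIn C v + 2 * 𝟙 (does (degIn C v ≟ 2))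
    balance v v∈M = charge-balance (min-deg v Cv) no-two-nbrs (λ d≤5 → subst (length (twoNbrs C v) + 2 ≤_)
        (length-filter+length-filter-∁ _ (nbr C v)) (+-monoʳ-≤ (length (twoNbrs C v)) (light-has-big v Cv d≤5)))
        (length-filter _ (nbr C v))
      where
      Cv : C v ≡ true
      Cv = member⁻ v∈M
      no-two-nbrs : degIn C v ≤ 3 → length (twoNbrs C v) ≡ 0
      no-two-nbrs d≤3 = cong length (filter-none _ (All.tabulate λ {u} u∈ d[u]≡2 →
        let vu , Cu = nbr-∈⁻ u∈ in
        <⇒≱ (s≤s d≤3) (two-nbrs-big u v Cu d[u]≡2 (nbr-∈⁺ (trans (Defs.sym G u v) vu) Cv))))
    dense : 6 * size C ≤ 2 * (2 * E)
    dense = +-cancelʳ-≤ (2 * W) (6 * size C) (2 * (2 * E)) (begin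
      6 * size C + 2 * W
        ≡⟨ trans (∑-+ _ _ M) (cong₂ _+_ (∑-const 6 M) (∑-twoNbrs C)) ⟨
      ∑[ v ← M ] (6 + length (twoNbrs C v))
        ≤⟨ ∑-mono M balance ⟩
      ∑[ v ← M ] (2 * degIn C v + 2 * 𝟙 (does (degIn C v ≟ 2)))
        ≡⟨ trans (∑-+ _ _ M) (cong₂ _+_ (trans (∑-*ˡ 2 _ M) (cong (2 *_) (handshake C))) (∑-*ˡ 2 _ M)) ⟩
      2 * (2 * E) + 2 * W
        ∎)
      where open ≤-Reasoning

  -- The third configuration is reducible only in the absence of the second, hence its first argument.
  data Configuration (C : VertexSet) : Set where
    leaf          : {v : V} → C v ≡ true → degIn C v ≤ 1 → Configuration C
    weak-2-vertex : {v u : V} → C v ≡ true → degIn C v ≡ 2 → u ∈ nbr C v → degIn C u ≤ 3 → Configuration C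
    light-vertex  : {c : V} → (∀ v u → C v ≡ true → degIn C v ≡ 2 → u ∈ nbr C v → 4 ≤ degIn C u) →
                    C c ≡ true → degIn C c ≤ 5 → length (bigNbrs C c) ≤ 1 → Configuration C

  unavoidable : MadLessThan G 3 → {C : VertexSet} {v₀ : V} → C v₀ ≡ true → Configuration C
  unavoidable mad {C} Cv₀ = decide (any? leaf? vertices) (any? weak? vertices) (any? light? vertices)
    where
    IsLeaf IsWeak IsLight : V → Set
    IsLeaf v = C v ≡ true × degIn C v ≤ 1
    IsWeak v = C v ≡ true × degIn C v ≡ 2 × Any (λ u → degIn C u ≤ 3) (nbr C v)
    IsLight v = C v ≡ true × degIn C v ≤ 5 × length (bigNbrs C v) ≤ 1
    leaf? : ∀ v → Dec (IsLeaf v)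
    leaf? v = (C v ≟ᵇ true) ×-dec (degIn C v ≤? 1)
    weak? : ∀ v → Dec (IsWeak v)
    weak? v = (C v ≟ᵇ true) ×-dec (degIn C v ≟ 2) ×-dec any? (λ u → degIn C u ≤? 3) (nbr C v)
    light? : ∀ v → Dec (IsLight v)
    light? v = (C v ≟ᵇ true) ×-dec (degIn C v ≤? 5) ×-dec (length (bigNbrs C v) ≤? 1)
    nowhere : {P : V → Set} → ¬ Any P vertices → ∀ v → ¬ P v
    nowhere none v p = none (lose (∈-allFin v) p)
    two-nbrs-big : ¬ Any IsWeak vertices → ∀ v u → C v ≡ true → degIn C v ≡ 2 → u ∈ nbr C v → 4 ≤ degIn C u
    two-nbrs-big no-weak v u Cv d≡2 u∈ = ≰⇒> λ d[u]≤3 → nowhere no-weak v (Cv , d≡2 , lose u∈ d[u]≤3)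
    decide : Dec (Any IsLeaf vertices) → Dec (Any IsWeak vertices) → Dec (Any IsLight vertices) → Configuration C
    decide (yes some-leaf) _ _ = let _ , _ , Cv , d≤1 = find some-leaf in leaf Cv d≤1
    decide (no _) (yes some-weak) _ =
      let _ , _ , Cv , d≡2 , some-u = find some-weak ; _ , u∈ , d[u]≤3 = find some-u in weak-2-vertex Cv d≡2 u∈ d[u]≤3
    decide (no _) (no no-weak) (yes some-light) =
      let _ , _ , Cc , d≤5 , big≤1 = find some-light in light-vertex (two-nbrs-big no-weak) Cc d≤5 big≤1
    decide (no no-leaf) (no no-weak) (no no-light) = ⊥-elim (discharging mad Cv₀
      (λ v Cv → ≰⇒> λ d≤1 → nowhere no-leaf v (Cv , d≤1))
      (two-nbrs-big no-weak)
      (λ v Cv d≤5 → ≰⇒> λ big≤1 → nowhere no-light v (Cv , d≤5 , big≤1)))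

module Reductions (G : Graph) (L : ListAssignment G)
                  (L-unique : ∀ v → Unique (L v)) (L-size : ∀ v → 8 ≤ length (L v)) where

  open Induced G
  open Colouring G L 3
  open Discharging G
  open DynamicOn

  Colourable : VertexSet → Set
  Colourable C = Σ (V → ℕ) (DynamicOn C)

  ColourableBelow : VertexSet → Set
  ColourableBelow C = ∀ {D} → size D < size C → Colourable D

  choose : (z : V) (F : List ℕ) → length F ≤ 7 → ∃[ a ] a ∈ L z × a ∉ F
  choose z F F≤7 = ∃-∉ F (L-unique z) (≤-trans (s≤s F≤7) (L-size z))

  length-forbidden≤ : {C D : VertexSet} {φ : V → ℕ} {z : V} {k : ℕ} → degIn C z ≤ k → length (forbidden C D φ z) ≤ 3 * k
  length-forbidden≤ {C} {D} {φ} {z} d≤k = ≤-trans (length-forbidden C D φ z) (*-monoʳ-≤ 3 d≤k)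

  reinsert : {C : VertexSet} {z : V} {φ : V → ℕ} → C z ≡ true → DynamicOn (insert z (C ∖ [ z ])) φ → DynamicOn C φ
  reinsert {C} Cz = DynamicOn-cong λ u → trans (insert-∖ {C} {zs = []} Cz (λ ()) u) (∖-[] C u)

  reduce-leaf : {C : VertexSet} {v : V} → ColourableBelow C → C v ≡ true → degIn C v ≤ 1 → Colourable C
  reduce-leaf {C} {v} below Cv d≤1 =
    let φ , col      = below (size-∖ {C} {zs = [ v ]} Cv (here refl))
        a , a∈L , a∉ = choose v (forbidden C′ C′ φ v) (≤-trans (length-forbidden≤ d′≤1) (m≤m+n 3 4))
    in φ [ v ↦ a ] ,
       reinsert {C} Cv (extend col (∖-removes {C} {[ v ]} (here refl)) a∈L a∉ (dynamic-≤1 3 φ (nbr C′ v) d′≤1))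
    where
    C′ : VertexSet
    C′ = C ∖ [ v ]
    d′≤1 : degIn C′ v ≤ 1
    d′≤1 = subst (λ ns → length ns ≤ 1) (sym (nbr-∖-self {C})) d≤1

  reduce-weak-2-vertex : {C : VertexSet} {v u : V} → ColourableBelow C →
                         C v ≡ true → degIn C v ≡ 2 → u ∈ nbr C v → degIn C u ≤ 3 → Colourable C
  reduce-weak-2-vertex {C} {v} {u} below Cv d≡2 u∈ d[u]≤3 =
    let φ , col      = below (size-∖ {C} {zs = [ v ]} Cv (here refl))
        a , a∈L , a∉ = choose u (forbidden C′ (C′ ∖ [ u ]) φ u ++ [ φ w ]) (length-F₁ φ)
        φ₁           = φ [ u ↦ a ]
        b , b∈L , b∉ = choose v (forbidden C′ C′ φ₁ v) (≤-trans (length-forbidden≤ (≤-reflexive d′≡2)) (n≤1+n 6))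
        col₁         = recolour col C′u a∈L (a∉ ∘ ∈-++⁺ˡ)
        φ₁u≢φ₁w      = λ e → a∉ (∈-++⁺ʳ (forbidden C′ (C′ ∖ [ u ]) φ u)
                             (here (trans (sym (update-≡ φ u a)) (trans e (update-≢ φ a w≢u)))))
    in φ₁ [ v ↦ b ] ,
       reinsert {C} Cv (extend col₁ (∖-removes {C} {[ v ]} (here refl)) b∈L b∉ (two-colours φ₁ φ₁u≢φ₁w))
    where
    C′ : VertexSet
    C′ = C ∖ [ v ]
    other : ∃[ w ] w ∈ nbr C v × w ≢ u
    other = other-member (nbr-unique C v) d≡2 u∈
    w : V
    w = proj₁ other
    w≢u : w ≢ u
    w≢u = proj₂ (proj₂ other)
    C′u : C′ u ≡ true
    C′u = ∖-intro {C} {[ v ]} (proj₂ (nbr-∈⁻ u∈)) λ { (here refl) → adj⇒≢ (proj₁ (nbr-∈⁻ u∈)) refl }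
    d′[u]≤2 : degIn C′ u ≤ 2
    d′[u]≤2 = s≤s⁻¹ (subst (_≤ 3) (degIn-∖ {C} Cv (trans (Defs.sym G u v) (proj₁ (nbr-∈⁻ u∈)))) d[u]≤3)
    length-F₁ : (φ : V → ℕ) → length (forbidden C′ (C′ ∖ [ u ]) φ u ++ [ φ w ]) ≤ 7
    length-F₁ φ = begin
      length (forbidden C′ (C′ ∖ [ u ]) φ u ++ [ φ w ]) ≡⟨ length-++ (forbidden C′ (C′ ∖ [ u ]) φ u) ⟩
      length (forbidden C′ (C′ ∖ [ u ]) φ u) + 1        ≤⟨ +-monoˡ-≤ 1 (length-forbidden≤ d′[u]≤2) ⟩
      7                                                 ∎
      where open ≤-Reasoning
    d′≡2 : degIn C′ v ≡ 2
    d′≡2 = trans (cong length (nbr-∖-self {C})) d≡2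
    two-colours : (φ : V → ℕ) → φ u ≢ φ w → 3 ⊓ degIn C′ v ≤ distinct (colours C′ φ v)
    two-colours φ = dynamic-2-vertex d′≡2 (subst (u ∈_) (sym (nbr-∖-self {C})) u∈)
                                          (subst (w ∈_) (sym (nbr-∖-self {C})) (proj₁ (proj₂ other)))

  add-2-vertices : {C : VertexSet} {c : V} {ψ : V → ℕ} (ts : List V) → Unique ts →
                   (∀ {t} → t ∈ ts → C t ≡ true × degIn C t ≡ 2 × c ∈ nbr C t) →
                   (∀ {t y} → t ∈ ts → y ∈ nbr C t → y ∉ ts) →
                   (∀ {t y} → t ∈ ts → y ∈ nbr C t → y ≢ c → ψ y ≢ ψ c) →
                   DynamicOn (C ∖ ts) ψ → Colourable C
  add-2-vertices {C} {ψ = ψ} [] _ _ _ _ col = ψ , DynamicOn-cong (∖-[] C) col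
  add-2-vertices {C} {c} {ψ} (t ∷ ts) (t∉ts ∷ ts-unique) shape outside separated col =
    let a , a∈L , a∉ = choose t (forbidden D D ψ t) (≤-trans (length-forbidden≤ (≤-reflexive dD≡2)) (n≤1+n 6))
    in add-2-vertices ts ts-unique (shape ∘ there) (λ t′∈ y∈ y∈ts → outside (there t′∈) y∈ (there y∈ts))
         (λ t′∈ y∈ y≢c → subst₂ _≢_ (sym (update-≢ ψ a (y≢t t′∈ y∈))) (sym (update-≢ ψ a c≢t))
                                    (separated (there t′∈) y∈ y≢c))
         (DynamicOn-cong (insert-∖ {C} Ct (λ t∈ts → All.lookup t∉ts t∈ts refl))
                         (extend col (∖-removes {C} {t ∷ ts} (here refl)) a∈L a∉ dynamic-t))
    where
    D : VertexSet
    D = C ∖ (t ∷ ts)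
    Ct : C t ≡ true
    Ct = proj₁ (shape (here refl))
    c∈ : c ∈ nbr C t
    c∈ = proj₂ (proj₂ (shape (here refl)))
    nbr-D : nbr D t ≡ nbr C t
    nbr-D = nbr-cong λ u tu → ∖-unchanged {C} (λ Cu → outside (here refl) (nbr-∈⁺ tu Cu))
    dD≡2 : degIn D t ≡ 2
    dD≡2 = trans (cong length nbr-D) (proj₁ (proj₂ (shape (here refl))))
    y≢t : ∀ {t′ y} → t′ ∈ ts → y ∈ nbr C t′ → y ≢ t
    y≢t t′∈ y∈ refl = outside (there t′∈) y∈ (here refl)
    c≢t : c ≢ t
    c≢t refl = outside (here refl) c∈ (here refl)
    dynamic-t : 3 ⊓ degIn D t ≤ distinct (colours D ψ t)
    dynamic-t with y , y∈ , y≢c ← other-member (nbr-unique C t) (proj₁ (proj₂ (shape (here refl)))) c∈ =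
      dynamic-2-vertex dD≡2 (subst (c ∈_) (sym nbr-D) c∈) (subst (y ∈_) (sym nbr-D) y∈)
                       (separated (here refl) y∈ y≢c ∘ sym)

  reduce-light-vertex : {C : VertexSet} {c : V} → ColourableBelow C →
                        (∀ v u → C v ≡ true → degIn C v ≡ 2 → u ∈ nbr C v → 4 ≤ degIn C u) →
                        C c ≡ true → degIn C c ≤ 5 → length (bigNbrs C c) ≤ 1 → Colourable C
  reduce-light-vertex {C} {c} below two-nbrs-big Cc d≤5 big≤1 =
    let φ , col      = below (size-∖ {C} {zs = c ∷ T} Cc (here refl))
        a , a∈L , a∉ = choose c (forbidden C′ C′ φ c ++ concatMap (colours C′ φ) T) (length-F φ)
    in add-2-vertices T (filter⁺ _ (nbr-unique C c)) shape outside (separated φ (a∉ ∘ ∈-++⁺ʳ (forbidden C′ C′ φ c)))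
         (DynamicOn-cong (insert-∖ {C} Cc c∉T)
                         (extend col (∖-removes {C} {c ∷ T} (here refl)) a∈L (a∉ ∘ ∈-++⁺ˡ)
                                 (dynamic-≤1 3 φ (nbr C′ c) d′≤1)))
    where
    T : List V
    T = twoNbrs C c
    C′ : VertexSet
    C′ = C ∖ (c ∷ T)
    shape : ∀ {t} → t ∈ T → C t ≡ true × degIn C t ≡ 2 × c ∈ nbr C t
    shape {t} t∈ = let t∈nbr , d≡2 = ∈-filter⁻ _ {xs = nbr C c} t∈ ; ct , Ct = nbr-∈⁻ t∈nbr in
      Ct , d≡2 , nbr-∈⁺ (trans (Defs.sym G t c) ct) Cc
    outside : ∀ {t y} → t ∈ T → y ∈ nbr C t → y ∉ T
    outside {t} {y} t∈ y∈ y∈T = let Ct , d≡2 , _ = shape t∈ in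
      <⇒≱ (n≤1+n 3) (subst (4 ≤_) (proj₂ (∈-filter⁻ _ {xs = nbr C c} y∈T)) (two-nbrs-big t y Ct d≡2 y∈))
    c∉T : c ∉ T
    c∉T c∈T = adj⇒≢ (proj₁ (nbr-∈⁻ (proj₁ (∈-filter⁻ _ {xs = nbr C c} c∈T)))) refl
    nbr-C′-c⊆big : nbr C′ c ⊆ bigNbrs C c
    nbr-C′-c⊆big {u} u∈ = let cu , C′u = nbr-∈⁻ u∈ ; Cu = ∖-⊆ {C} {c ∷ T} C′u in
      ∈-filter⁺ _ (nbr-∈⁺ cu Cu) λ d≡2 → ∖-excludes {C} {c ∷ T} C′u (there (∈-filter⁺ _ (nbr-∈⁺ cu Cu) d≡2))
    d′≤big : degIn C′ c ≤ length (bigNbrs C c)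
    d′≤big = Unique-⊆⇒length≤ (nbr-unique C′ c) nbr-C′-c⊆big
    d′≤1 : degIn C′ c ≤ 1
    d′≤1 = ≤-trans d′≤big big≤1
    d′[t]≤1 : ∀ {t} → t ∈ T → degIn C′ t ≤ 1
    d′[t]≤1 {t} t∈ =
      s≤s⁻¹ (subst (suc (degIn C′ t) ≤_) (proj₁ (proj₂ (shape t∈))) (Unique-⊆⇒length≤ (c∉ ∷ nbr-unique C′ t) ⊆nbr))
      where
      c∉ : All (c ≢_) (nbr C′ t)
      c∉ = All.tabulate λ { u∈ refl → ∖-excludes {C} {c ∷ T} (proj₂ (nbr-∈⁻ u∈)) (here refl) }
      ⊆nbr : c ∷ nbr C′ t ⊆ nbr C t
      ⊆nbr (here refl) = proj₂ (proj₂ (shape t∈))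
      ⊆nbr (there u∈) = let tu , C′u = nbr-∈⁻ u∈ in nbr-∈⁺ tu (∖-⊆ {C} {c ∷ T} C′u)
    length-W : (φ : V → ℕ) → length (concatMap (colours C′ φ) T) ≤ length T
    length-W φ = begin
      length (concatMap (colours C′ φ) T)
        ≡⟨ length-concatMap≡∑ _ T ⟩
      ∑[ t ← T ] length (colours C′ φ t)
        ≤⟨ ∑-mono T (λ t t∈ → subst (_≤ 1) (sym (length-map φ (nbr C′ t))) (d′[t]≤1 t∈)) ⟩
      ∑[ t ← T ] 1
        ≡⟨ length≡∑ T ⟨
      length T
        ∎
      where open ≤-Reasoning
    budget : ∀ {m t} → m ≤ 1 → t + m ≤ 5 → 3 * m + t ≤ 7
    budget {0} {t} _ t≤5 = ≤-trans (subst (_≤ 5) (+-identityʳ t) t≤5) (m≤m+n 5 2)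
    budget {1} {t} _ t+1≤5 = s≤s (s≤s (s≤s (s≤s⁻¹ (subst (_≤ 5) (+-comm t 1) t+1≤5))))
    budget {suc (suc _)} (s≤s ())
    length-F : (φ : V → ℕ) → length (forbidden C′ C′ φ c ++ concatMap (colours C′ φ) T) ≤ 7
    length-F φ = begin
      length (forbidden C′ C′ φ c ++ concatMap (colours C′ φ) T)
        ≡⟨ length-++ (forbidden C′ C′ φ c) ⟩
      length (forbidden C′ C′ φ c) + length (concatMap (colours C′ φ) T)
        ≤⟨ +-mono-≤ (length-forbidden≤ ≤-refl) (length-W φ) ⟩
      3 * degIn C′ c + length T
        ≤⟨ budget d′≤1 T+d′≤5 ⟩
      7
        ∎
      where
      open ≤-Reasoning
      T+d′≤5 : length T + degIn C′ c ≤ 5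
      T+d′≤5 = ≤-trans (+-monoʳ-≤ (length T) d′≤big) (subst (_≤ 5) (sym (length-filter+length-filter-∁ _ (nbr C c))) d≤5)
    separated : (φ : V → ℕ) {a : ℕ} → a ∉ concatMap (colours C′ φ) T →
                ∀ {t y} → t ∈ T → y ∈ nbr C t → y ≢ c → (φ [ c ↦ a ]) y ≢ (φ [ c ↦ a ]) c
    separated φ {a} a∉ {t} {y} t∈ y∈ y≢c φ′y≡φ′c =
      a∉ (∈-concatMap⁺ (colours C′ φ) (Any.map (λ { refl → φy∈ }) t∈))
      where
      y∈nbr′ : y ∈ nbr C′ t
      y∈nbr′ = let ty , Cy = nbr-∈⁻ y∈ in
        nbr-∈⁺ ty (∖-intro {C} {c ∷ T} Cy λ { (here y≡c) → y≢c y≡c ; (there y∈T) → outside t∈ y∈ y∈T })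
      φy≡a : φ y ≡ a
      φy≡a = trans (sym (update-≢ φ a y≢c)) (trans φ′y≡φ′c (update-≡ φ c a))
      φy∈ : a ∈ colours C′ φ t
      φy∈ = subst (_∈ colours C′ φ t) φy≡a (∈-map⁺ φ y∈nbr′)

  reduce : {C : VertexSet} → ColourableBelow C → Configuration C → Colourable C
  reduce below (leaf Cv d≤1) = reduce-leaf below Cv d≤1
  reduce below (weak-2-vertex Cv d≡2 u∈ d[u]≤3) = reduce-weak-2-vertex below Cv d≡2 u∈ d[u]≤3
  reduce below (light-vertex two-nbrs-big Cc d≤5 big≤1) = reduce-light-vertex below two-nbrs-big Cc d≤5 big≤1

  colourable : MadLessThan G 3 → (C : VertexSet) → Colourable C
  colourable mad = WF.All.wfRec (On.wellFounded size <-wellFounded) 0ℓ Colourable step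
    where
    step : (C : VertexSet) → ColourableBelow C → Colourable C
    step C below with any? (λ v → C v ≟ᵇ true) vertices
    ... | yes nonempty = reduce below (unavoidable mad (proj₂ (proj₂ (find nonempty))))
    ... | no empty = (λ _ → 0) , DynamicOn-∅ _ (λ v → ¬-not (empty ∘ lose (∈-allFin v)))

theorem1p5 : (G : Graph) → MadLessThan G 3 → ListDynChromatic≤ 3 G 8
theorem1p5 G mad L L-unique L-size =
  φ , (λ v → fromLists col v refl) , (λ u v → proper col u v refl refl) , dynamic′
  where
  open Induced G
  open Colouring G L 3
  open Reductions G L L-unique L-size
  open DynamicOn
  everything : VertexSet
  everything _ = true
  φ : V → ℕ
  φ = proj₁ (colourable mad everything)
  col : DynamicOn everything φ
  col = proj₂ (colourable mad everything)
  dynamic′ : ∀ v → 3 ⊓ deg G v ≤ numNbrColours G φ v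
  dynamic′ v = subst (λ ns → 3 ⊓ length ns ≤ distinct (map φ ns)) (sym nbrs≡nbr) (dynamic col v refl)
    where
    nbrs≡nbr : nbrs G v ≡ nbr everything v
    nbrs≡nbr = filter-≐ _ _ ((λ {u} → trans (∧-identityʳ (adj G v u))) , (λ {u} → trans (sym (∧-identityʳ (adj G v u)))))
                        vertices
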